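{- Let $k\ge1$, $m\ge0$ and $0\le l<k$ be integers with $km+l\ge1$. Then \[ \mathrm{mp}_{213,132}(km+l,k)=\begin{cases}2^{m-1} & \text{if } l=0,\\ F_{2m+1} & \text{otherwise},\end{cases} \] where $F_n$ are the Fibonacci numbers with $F_1=F_2=1$.
   Context: A permutation $\pi$ of $[n]$ is mod-$k$-alternating if $\pi(i)\equiv i\pmod k$ for all $i$. A permutation contains a pattern $\sigma$ if some subsequence of its one-line notation is order-isomorphic to $\sigma$, and avoids it otherwise. $\mathrm{mp}_{\sigma,\tau}(n,k)$ is the number of mod-$k$-alternating permutations of $[n]$ avoiding both $\sigma$ and $\tau$. -}

module Defs where

open import Data.Nat using (ℕ; zero; suc; ∣_-_∣)
open import Data.Nat.Divisibility using (_∣_; _∣?_)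
open import Data.Fin using (Fin; toℕ; _<_; _<?_) renaming (zero to fz; suc to fs)
open import Data.Fin.Properties using (any?; all?) renaming (_≟_ to _≟F_)
open import Data.Vec using (Vec; []; _∷_; lookup)
open import Data.List using (List; [_]; map; concatMap; allFin; filter; length)
open import Data.Product using (_×_; ∃)
open import Relation.Binary.PropositionalEquality using (_≡_)
open import Relation.Nullary using (Dec; ¬_; ¬?)
open import Relation.Nullary.Decidable using (_×-dec_; _→-dec_)

fib : ℕ → ℕ
fib zero = 0
fib (suc zero) = 1
fib (suc (suc n)) = fib n + fib (suc n)
  where open Data.Nat using (_+_)

-- A word of length n over [n] in one-line notation (0-based values/positions:
-- value j stands for j+1 and position i for i+1).
Word : ℕ → Set
Word n = Vec (Fin n) n

IsPerm : ∀ {n} → Word n → Set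
IsPerm {n} π = ∀ (i j : Fin n) → lookup π i ≡ lookup π j → i ≡ j

_≡_[mod_] : ℕ → ℕ → ℕ → Set
a ≡ b [mod k ] = k ∣ ∣ a - b ∣

ModAlt : ∀ {n} → ℕ → Word n → Set
ModAlt {n} k π = ∀ (i : Fin n) → suc (toℕ (lookup π i)) ≡ suc (toℕ i) [mod k ]

OrderIso3 : ∀ {n} → (Fin 3 → Fin n) → Vec (Fin 3) 3 → Set
OrderIso3 w σ = ∀ (a b : Fin 3) →
  ((w a < w b → lookup σ a < lookup σ b) × (lookup σ a < lookup σ b → w a < w b))

val3 : ∀ {n} → Word n → Fin n → Fin n → Fin n → Fin 3 → Fin n
val3 π i j l fz = lookup π i
val3 π i j l (fs fz) = lookup π j
val3 π i j l (fs (fs fz)) = lookup π l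

Contains3 : ∀ {n} → Word n → Vec (Fin 3) 3 → Set
Contains3 {n} π σ = ∃ λ (i : Fin n) → ∃ λ (j : Fin n) → ∃ λ (l : Fin n) →
  (i < j) × (j < l) × OrderIso3 (val3 π i j l) σ

Avoids3 : ∀ {n} → Word n → Vec (Fin 3) 3 → Set
Avoids3 π σ = ¬ Contains3 π σ

p213 : Vec (Fin 3) 3
p213 = fs fz ∷ fz ∷ fs (fs fz) ∷ []

p132 : Vec (Fin 3) 3
p132 = fz ∷ fs (fs fz) ∷ fs fz ∷ []

isPerm? : ∀ {n} (π : Word n) → Dec (IsPerm π)
isPerm? π = all? λ i → all? λ j → (lookup π i ≟F lookup π j) →-dec (i ≟F j)

modAlt? : ∀ {n} k (π : Word n) → Dec (ModAlt k π)
modAlt? k π = all? λ i → k ∣? _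

orderIso3? : ∀ {n} (w : Fin 3 → Fin n) σ → Dec (OrderIso3 w σ)
orderIso3? w σ = all? λ a → all? λ b →
  ((w a <? w b) →-dec (lookup σ a <? lookup σ b)) ×-dec
  ((lookup σ a <? lookup σ b) →-dec (w a <? w b))

contains3? : ∀ {n} (π : Word n) σ → Dec (Contains3 π σ)
contains3? π σ = any? λ i → any? λ j → any? λ l →
  (i <? j) ×-dec ((j <? l) ×-dec orderIso3? (val3 π i j l) σ)

allWords : ∀ m n → List (Vec (Fin m) n)
allWords m zero = [ [] ]
allWords m (suc n) = concatMap (λ x → map (x ∷_) (allWords m n)) (allFin m)

Good : ℕ → ∀ {n} → Word n → Set
Good k π = IsPerm π × ModAlt k π × Avoids3 π p213 × Avoids3 π p132

good? : ∀ k {n} (π : Word n) → Dec (Good k π)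
good? k π = isPerm? π ×-dec (modAlt? k π ×-dec (¬? (contains3? π p213) ×-dec ¬? (contains3? π p132)))

mp213-132 : ℕ → ℕ → ℕ
mp213-132 n k = length (filter (good? k) (allWords n n))

{-# OPTIONS --safe #-}
-- A permutation avoids 213 and 132 exactly when every ascent π(a) < π(b) satisfies
-- π(b) − π(a) = b − a: it is a sequence of runs of consecutive increasing values, each run
-- ending at the largest value not used before it. Such a permutation is determined by the
-- values at which its runs start, and being mod-k-alternating only constrains those starts: a
-- run starting at position p with value x needs x ≡ p (mod k). Hence the number f(J) of such
-- suffixes of length J (values 0, …, J − 1 at positions n − J, …, n − 1) satisfies f(0) = 1 and
-- f(J) = Σ { f(x) | x < J, x ≡ n − J (mod k) }. For n = km + l, splitting these sums into periods
-- of length k gives f(k(t + 1)) = 2ᵗ when l = 0, and f(kt + l) = F(2t + 1), f(k(t + 1)) = F(2t + 2)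
-- when l > 0, both by induction on t.
module Submission where

open import Defs
open import Data.Empty using (⊥; ⊥-elim)
open import Data.Fin using (Fin; toℕ; fromℕ<; punchOut) renaming (zero to fz; suc to fs)
open import Data.Fin.Properties using (any?; toℕ<n; toℕ-fromℕ<; toℕ-injective; punchOut-injective; injective⇒≤)
open import Data.List using (List; []; _∷_; _++_; length; filter; map; concatMap; tabulate; allFin)
open import Data.List.Properties using (filter-≐; filter-++; filter-none; length-++; map-tabulate; tabulate-cong)
open import Data.List.Relation.Unary.All using (universal)
open import Data.Nat using (ℕ; zero; suc; pred; _+_; _*_; _∸_; _^_; _%_; _/_; ∣_-_∣; _≤_; _<_; z≤n; s≤s; z<s; s<s;
  _≟_; _≤?_; _<?_; NonZero; >-nonZero; >-nonZero⁻¹)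
open import Data.Nat.DivMod using (%-remove-+ʳ; %-distribˡ-+; m≡m%n+[m/n]*n; [m+kn]%n≡m%n; m<n⇒m%n≡m; m*n%n≡0)
open import Data.Nat.Divisibility using (_∣_; divides)
open import Data.Nat.Induction using (<-rec)
open import Data.Nat.ListAction using (sum)
open import Data.Nat.Properties
open import Algebra.Properties.CommutativeSemigroup +-commutativeSemigroup using (xy∙z≈xz∙y; x∙yz≈y∙xz)
open import Data.Product using (∃; _×_; _,_; proj₁; proj₂)
open import Data.Sum using (_⊎_; inj₁; inj₂)
open import Data.Vec using (Vec; lookup) renaming (_∷_ to _∷ᵥ_; [] to []ᵥ)
open import Function using (_∘_)
open import Relation.Binary.Definitions using (tri<; tri≈; tri>)
open import Relation.Binary.PropositionalEquality
  using (_≡_; _≢_; refl; sym; trans; cong; cong₂; subst; subst₂; module ≡-Reasoning)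
open import Relation.Nullary using (Dec; yes; no; ¬_)
open import Relation.Nullary.Decidable using (_×-dec_)
open import Relation.Unary using (Pred; Decidable)

∑< : ℕ → (ℕ → ℕ) → ℕ
∑< zero    f = 0
∑< (suc n) f = ∑< n f + f n

syntax ∑< n (λ i → e) = ∑[ i < n ] e

∑<-cong : ∀ n {f g : ℕ → ℕ} → (∀ i → i < n → f i ≡ g i) → ∑< n f ≡ ∑< n g
∑<-cong zero    _  = refl
∑<-cong (suc n) eq = cong₂ _+_ (∑<-cong n (λ i i<n → eq i (m<n⇒m<1+n i<n))) (eq n ≤-refl)

∑<-+ : ∀ m n f → ∑< (m + n) f ≡ ∑< m f + ∑[ i < n ] f (m + i)
∑<-+ m zero    f = trans (cong (λ p → ∑< p f) (+-identityʳ m)) (sym (+-identityʳ _))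
∑<-+ m (suc n) f = begin
  ∑< (m + suc n) f                              ≡⟨ cong (λ p → ∑< p f) (+-suc m n) ⟩
  ∑< (m + n) f + f (m + n)                      ≡⟨ cong (_+ f (m + n)) (∑<-+ m n f) ⟩
  ∑< m f + ∑[ i < n ] f (m + i) + f (m + n)     ≡⟨ +-assoc (∑< m f) _ _ ⟩
  ∑< m f + ∑[ i < suc n ] f (m + i)             ∎
  where open ≡-Reasoning

∑<-zero : ∀ n {f} → (∀ i → i < n → f i ≡ 0) → ∑< n f ≡ 0
∑<-zero zero    _ = refl
∑<-zero (suc n) z = cong₂ _+_ (∑<-zero n (λ i i<n → z i (m<n⇒m<1+n i<n))) (z n ≤-refl)

∑<-single : ∀ n {f} v → v < n → (∀ i → i < n → i ≢ v → f i ≡ 0) → ∑< n f ≡ f v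
∑<-single (suc n) {f} v v<1+n z with m<1+n⇒m<n∨m≡n v<1+n
... | inj₁ v<n = trans (cong₂ _+_ (∑<-single n v v<n (λ i i<n → z i (m<n⇒m<1+n i<n)))
                                  (z n ≤-refl (λ n≡v → <-irrefl (sym n≡v) v<n)))
                       (+-identityʳ (f v))
... | inj₂ refl = cong (_+ f v) (∑<-zero n (λ i i<n → z i (m<n⇒m<1+n i<n) (<⇒≢ i<n)))

∑<-truncate : ∀ {m n f} → m ≤ n → (∀ i → m ≤ i → i < n → f i ≡ 0) → ∑< n f ≡ ∑< m f
∑<-truncate {m} {n} {f} m≤n z = begin
  ∑< n f                              ≡⟨ cong (λ p → ∑< p f) (m+[n∸m]≡n m≤n) ⟨
  ∑< (m + (n ∸ m)) f                  ≡⟨ ∑<-+ m (n ∸ m) f ⟩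
  ∑< m f + ∑[ i < n ∸ m ] f (m + i)   ≡⟨ cong (∑< m f +_) (∑<-zero (n ∸ m) vanish) ⟩
  ∑< m f + 0                          ≡⟨ +-identityʳ _ ⟩
  ∑< m f                              ∎
  where
  open ≡-Reasoning
  vanish : ∀ i → i < n ∸ m → f (m + i) ≡ 0
  vanish i i<n∸m = z (m + i) (m≤m+n m i) (subst (m + i <_) (m+[n∸m]≡n m≤n) (+-monoʳ-< m i<n∸m))

sum-tabulate-toℕ : ∀ n f → sum (tabulate {n = n} (λ i → f (toℕ i))) ≡ ∑< n f
sum-tabulate-toℕ zero    f = refl
sum-tabulate-toℕ (suc n) f =
  trans (cong (f 0 +_) (sum-tabulate-toℕ n (λ i → f (suc i)))) (sym (∑<-+ 1 n f))

iverson : ∀ {a} {A : Set a} → Dec A → ℕ → ℕ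
iverson (yes _) n = n
iverson (no _)  _ = 0

iverson-yes : ∀ {a} {A : Set a} (A? : Dec A) {n} → A → iverson A? n ≡ n
iverson-yes (yes _) _ = refl
iverson-yes (no ¬a) a = ⊥-elim (¬a a)

iverson-no : ∀ {a} {A : Set a} (A? : Dec A) {n} → ¬ A → iverson A? n ≡ 0
iverson-no (yes a) ¬a = ⊥-elim (¬a a)
iverson-no (no _)  _  = refl

count : ∀ {a p} {A : Set a} {P : Pred A p} → Decidable P → List A → ℕ
count P? xs = length (filter P? xs)

module _ {a p} {A : Set a} {P : Pred A p} (P? : Decidable P) where

  count-concatMap : ∀ {b} {B : Set b} (g : B → List A) xs →
                    count P? (concatMap g xs) ≡ sum (map (λ x → count P? (g x)) xs)
  count-concatMap g []       = refl
  count-concatMap g (x ∷ xs) = begin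
    length (filter P? (g x ++ concatMap g xs))           ≡⟨ cong length (filter-++ P? (g x) _) ⟩
    length (filter P? (g x) ++ filter P? (concatMap g xs)) ≡⟨ length-++ (filter P? (g x)) ⟩
    count P? (g x) + count P? (concatMap g xs)           ≡⟨ cong (count P? (g x) +_) (count-concatMap g xs) ⟩
    sum (map (λ x → count P? (g x)) (x ∷ xs))            ∎
    where open ≡-Reasoning

  count-map : ∀ {b} {B : Set b} (f : B → A) xs → count P? (map f xs) ≡ count (λ x → P? (f x)) xs
  count-map f []       = refl
  count-map f (x ∷ xs) with P? (f x)
  ... | yes _ = cong suc (count-map f xs)
  ... | no _  = count-map f xs

count-×-dec : ∀ {a b q} {A : Set a} {B : Set b} {Q : Pred A q} (B? : Dec B) (Q? : Decidable Q) xs →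
              count (λ x → B? ×-dec Q? x) xs ≡ iverson B? (count Q? xs)
count-×-dec (yes b) Q? xs = cong length (filter-≐ _ Q? (proj₂ , (b ,_)) xs)
count-×-dec (no ¬b) Q? xs = cong length (filter-none _ (universal (λ _ → ¬b ∘ proj₁) xs))

count-allWords-suc : ∀ N {p j} {P : Pred (Vec (Fin N) (suc j)) p} (P? : Decidable P) (f : ℕ → ℕ) →
  (∀ x → count (λ w → P? (x ∷ᵥ w)) (allWords N j) ≡ f (toℕ x)) → count P? (allWords N (suc j)) ≡ ∑< N f
count-allWords-suc N {j = j} P? f count≡f = begin
  count P? (concatMap (λ x → map (x ∷ᵥ_) (allWords N j)) (allFin N))
    ≡⟨ count-concatMap P? _ (allFin N) ⟩
  sum (map (λ x → count P? (map (x ∷ᵥ_) (allWords N j))) (allFin N))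
    ≡⟨ cong sum (map-tabulate {n = N} (λ x → x) (λ x → count P? (map (x ∷ᵥ_) (allWords N j)))) ⟩
  sum (tabulate {n = N} (λ x → count P? (map (x ∷ᵥ_) (allWords N j))))
    ≡⟨ cong sum (tabulate-cong (λ x → trans (count-map P? (x ∷ᵥ_) (allWords N j)) (count≡f x))) ⟩
  sum (tabulate {n = N} (λ x → f (toℕ x)))
    ≡⟨ sum-tabulate-toℕ N f ⟩
  ∑< N f ∎
  where open ≡-Reasoning

module _ {d : ℕ} .{{_ : NonZero d}} where

  d∣n∸m⇒m%d≡n%d : ∀ {m n} → m ≤ n → d ∣ n ∸ m → m % d ≡ n % d
  d∣n∸m⇒m%d≡n%d {m} {n} m≤n d∣n∸m = begin
    m % d            ≡⟨ %-remove-+ʳ m d∣n∸m ⟨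
    (m + (n ∸ m)) % d ≡⟨ cong (_% d) (m+[n∸m]≡n m≤n) ⟩
    n % d            ∎
    where open ≡-Reasoning

  m%d≡n%d⇒d∣n∸m : ∀ {m n} → m % d ≡ n % d → d ∣ n ∸ m
  m%d≡n%d⇒d∣n∸m {m} {n} eq = divides (n / d ∸ m / d) (begin
    n ∸ m                                     ≡⟨ cong₂ _∸_ (m≡m%n+[m/n]*n n d) (m≡m%n+[m/n]*n m d) ⟩
    (n % d + n / d * d) ∸ (m % d + m / d * d) ≡⟨ cong (λ r → (r + n / d * d) ∸ (m % d + m / d * d)) eq ⟨
    (m % d + n / d * d) ∸ (m % d + m / d * d) ≡⟨ [m+n]∸[m+o]≡n∸o (m % d) _ _ ⟩
    n / d * d ∸ m / d * d                     ≡⟨ *-distribʳ-∸ d (n / d) (m / d) ⟨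
    (n / d ∸ m / d) * d                       ∎)
    where open ≡-Reasoning

  %-cong-+ʳ : ∀ {m n} o → m % d ≡ n % d → (m + o) % d ≡ (n + o) % d
  %-cong-+ʳ {m} {n} o eq = begin
    (m + o) % d            ≡⟨ %-distribˡ-+ m o d ⟩
    (m % d + o % d) % d    ≡⟨ cong (λ r → (r + o % d) % d) eq ⟩
    (n % d + o % d) % d    ≡⟨ %-distribˡ-+ n o d ⟨
    (n + o) % d            ∎
    where open ≡-Reasoning

  d∣∣m-n∣⇒m%d≡n%d : ∀ m n → d ∣ ∣ m - n ∣ → m % d ≡ n % d
  d∣∣m-n∣⇒m%d≡n%d m n d∣ with ≤-total m n
  ... | inj₁ m≤n = d∣n∸m⇒m%d≡n%d m≤n (subst (d ∣_) (m≤n⇒∣m-n∣≡n∸m m≤n) d∣)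
  ... | inj₂ n≤m = sym (d∣n∸m⇒m%d≡n%d n≤m (subst (d ∣_) (m≤n⇒∣n-m∣≡n∸m n≤m) d∣))

  m%d≡n%d⇒d∣∣m-n∣ : ∀ m n → m % d ≡ n % d → d ∣ ∣ m - n ∣
  m%d≡n%d⇒d∣∣m-n∣ m n eq with ≤-total m n
  ... | inj₁ m≤n = subst (d ∣_) (sym (m≤n⇒∣m-n∣≡n∸m m≤n)) (m%d≡n%d⇒d∣n∸m eq)
  ... | inj₂ n≤m = subst (d ∣_) (sym (m≤n⇒∣n-m∣≡n∸m n≤m)) (m%d≡n%d⇒d∣n∸m (sym eq))

+-cross : ∀ u v w p q r → u + p ≡ v + q → u + r ≡ w + q → v + r ≡ w + p
+-cross u v w p q r e₁ e₂ = +-cancelʳ-≡ q _ _ (begin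
  v + r + q ≡⟨ xy∙z≈xz∙y v r q ⟩
  v + q + r ≡⟨ cong (_+ r) e₁ ⟨
  u + p + r ≡⟨ xy∙z≈xz∙y u p r ⟩
  u + r + p ≡⟨ cong (_+ p) e₂ ⟩
  w + q + p ≡⟨ xy∙z≈xz∙y w q p ⟩
  w + p + q ∎)
  where open ≡-Reasoning

record PermOn (J : ℕ) (h : ℕ → ℕ) : Set where
  field
    bounded   : ∀ {a} → a < J → h a < J
    injective : ∀ {a b} → a < J → b < J → h a ≡ h b → a ≡ b

surjective : ∀ {J h} → PermOn J h → ∀ {v} → v < J → ∃ λ a → a < J × h a ≡ v
surjective {suc J} {h} perm {v} v<J with any? (λ (a : Fin (suc J)) → h (toℕ a) ≟ v)
... | yes (a , ha≡v) = toℕ a , toℕ<n a , ha≡v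
... | no ∄a = ⊥-elim (<-irrefl refl (injective⇒≤ squeeze-injective))
  where
  -- Pigeonhole: with v missed, punching v out of the image injects Fin (suc J) into Fin J.
  open PermOn perm
  image : Fin (suc J) → Fin (suc J)
  image a = fromℕ< (bounded (toℕ<n a))
  image≢v : ∀ a → fromℕ< v<J ≢ image a
  image≢v a eq = ∄a (a , (begin
    h (toℕ a)         ≡⟨ toℕ-fromℕ< _ ⟨
    toℕ (image a)     ≡⟨ cong toℕ eq ⟨
    toℕ (fromℕ< v<J)  ≡⟨ toℕ-fromℕ< v<J ⟩
    v                 ∎))
    where open ≡-Reasoning
  squeeze : Fin (suc J) → Fin J
  squeeze a = punchOut (image≢v a)
  squeeze-injective : ∀ {a b} → squeeze a ≡ squeeze b → a ≡ b
  squeeze-injective {a} {b} eq = toℕ-injective (injective (toℕ<n a) (toℕ<n b) (begin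
    h (toℕ a)      ≡⟨ toℕ-fromℕ< _ ⟨
    toℕ (image a)  ≡⟨ cong toℕ (punchOut-injective (image≢v a) (image≢v b) eq) ⟩
    toℕ (image b)  ≡⟨ toℕ-fromℕ< _ ⟩
    h (toℕ b)      ∎))
    where open ≡-Reasoning

Avoids213On : ℕ → (ℕ → ℕ) → Set
Avoids213On J h = ∀ {a b c} → a < b → b < c → c < J → h b < h a → h a < h c → ⊥

Avoids132On : ℕ → (ℕ → ℕ) → Set
Avoids132On J h = ∀ {a b c} → a < b → b < c → c < J → h a < h c → h c < h b → ⊥

-- h b − h a = b − a for every ascent a < b, h a < h b, stated without truncated subtraction.
AscentsRigid : ℕ → (ℕ → ℕ) → Set
AscentsRigid J h = ∀ {a b} → a < b → b < J → h a < h b → h b + a ≡ h a + b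

ascentsRigid⇒avoids213 : ∀ {J h} → AscentsRigid J h → Avoids213On J h
ascentsRigid⇒avoids213 {h = h} rigid {a} {b} {c} a<b b<c c<J hb<ha ha<hc =
  <-irrefl (sym (+-cross (h c) (h a) (h b) a c b
                  (rigid (<-trans a<b b<c) c<J ha<hc) (rigid b<c c<J (<-trans hb<ha ha<hc))))
           (+-mono-< hb<ha a<b)

ascentsRigid⇒avoids132 : ∀ {J h} → AscentsRigid J h → Avoids132On J h
ascentsRigid⇒avoids132 {h = h} rigid {a} {b} {c} a<b b<c c<J ha<hc hc<hb =
  <-irrefl (sym (+-cross (h a) (h b) (h c) b a c
                  (sym (rigid a<b (<-trans b<c c<J) (<-trans ha<hc hc<hb))) (sym (rigid (<-trans a<b b<c) c<J ha<hc))))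
           (+-mono-< hc<hb b<c)

module _ {J : ℕ} {h : ℕ → ℕ} (perm : PermOn J h) (av213 : Avoids213On J h) (av132 : Avoids132On J h) where
  open PermOn perm

  -- The value u just below the top of an ascent must sit right before it: anywhere else it
  -- forms a 213 or a 132 together with the top.
  ascent-predecessor : ∀ {a b u} → a < suc b → suc b < J → h (suc b) ≡ suc u → h a ≤ u → h b ≡ u
  ascent-predecessor {a} {b} {u} a<b′ b′<J hb′≡1+u ha≤u =
    locate (surjective perm (<-trans u<hb′ (bounded b′<J)))
    where
    u<hb′ : u < h (suc b)
    u<hb′ = ≤-reflexive (sym hb′≡1+u)
    locate : (∃ λ q → q < J × h q ≡ u) → h b ≡ u
    locate (q , q<J , hq≡u) with <-cmp q b
    ... | tri≈ _ refl _ = hq≡u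
    ... | tri< q<b _ _ with <-cmp (h b) u
    ...   | tri≈ _ hb≡u _ = hb≡u
    ...   | tri< hb<u _ _ = ⊥-elim (av213 q<b (n<1+n b) b′<J
                              (subst (h b <_) (sym hq≡u) hb<u) (subst (_< h (suc b)) (sym hq≡u) u<hb′))
    ...   | tri> _ _ u<hb = ⊥-elim (av132 q<b (n<1+n b) b′<J (subst (_< h (suc b)) (sym hq≡u) u<hb′) hb′<hb)
      where
      hb≢1+u : h b ≢ suc u
      hb≢1+u hb≡1+u = <-irrefl (injective (<-trans (n<1+n b) b′<J) b′<J (trans hb≡1+u (sym hb′≡1+u))) (n<1+n b)
      hb′<hb : h (suc b) < h b
      hb′<hb = subst (_< h b) (sym hb′≡1+u) (≤∧≢⇒< u<hb (hb≢1+u ∘ sym))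
    locate (q , q<J , hq≡u) | tri> _ _ b<q with m≤n⇒m<n∨m≡n b<q
    ... | inj₂ refl = ⊥-elim (<-irrefl (trans (sym hq≡u) hb′≡1+u) (n<1+n u))
    ... | inj₁ b′<q = ⊥-elim (av132 a<b′ b′<q q<J ha<hq (subst (_< h (suc b)) (sym hq≡u) u<hb′))
      where
      ha≢u : h a ≢ u
      ha≢u ha≡u = <-irrefl (injective (<-trans a<b′ b′<J) q<J (trans ha≡u (sym hq≡u))) (<-trans a<b′ b′<q)
      ha<hq : h a < h q
      ha<hq = subst (h a <_) (sym hq≡u) (≤∧≢⇒< ha≤u ha≢u)

  avoids⇒ascentsRigid : AscentsRigid J h
  avoids⇒ascentsRigid {a} {suc b} a<b′ b′<J ha<hb′ = extend (m<1+n⇒m<n∨m≡n a<b′)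
    where
    open ≡-Reasoning
    u = pred (h (suc b))
    hb′≡1+u : h (suc b) ≡ suc u
    hb′≡1+u = sym (suc-pred (h (suc b)) {{>-nonZero (≤-<-trans z≤n ha<hb′)}})
    hb≡u : h b ≡ u
    hb≡u = ascent-predecessor a<b′ b′<J hb′≡1+u (<⇒≤pred ha<hb′)
    extend : a < b ⊎ a ≡ b → h (suc b) + a ≡ h a + suc b
    extend (inj₂ refl) = begin
      h (suc b) + b  ≡⟨ cong (_+ b) hb′≡1+u ⟩
      suc u + b      ≡⟨ cong (λ z → suc z + b) hb≡u ⟨
      suc (h b + b)  ≡⟨ +-suc (h b) b ⟨
      h b + suc b    ∎
    extend (inj₁ a<b) = begin
      h (suc b) + a  ≡⟨ cong (_+ a) hb′≡1+u ⟩
      suc u + a      ≡⟨ cong (λ z → suc z + a) hb≡u ⟨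
      suc (h b + a)  ≡⟨ cong suc (avoids⇒ascentsRigid a<b b<J ha<hb) ⟩
      suc (h a + b)  ≡⟨ +-suc (h a) b ⟨
      h a + suc b    ∎
      where
      b<J = <-trans (n<1+n b) b′<J
      ha<hb : h a < h b
      ha<hb = ≤∧≢⇒< (subst (h a ≤_) (sym hb≡u) (<⇒≤pred ha<hb′))
                    (λ ha≡hb → <-irrefl (injective (<-trans a<b b<J) b<J ha≡hb) a<b)

+-suc-shift : ∀ c p i → p + suc (c + i) ≡ suc c + (p + i)
+-suc-shift c p i = trans (+-suc p (c + i)) (cong suc (x∙yz≈y∙xz p c i))

-- h on positions 0, …, j splits into a run h 0, …, h 0 + c at positions 0, …, c and the rest.
module HeadRun (j : ℕ) (h : ℕ → ℕ) where

  c : ℕ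
  c = j ∸ h 0

  rest : ℕ → ℕ
  rest i = h (suc (c + i))

  Run : Set
  Run = ∀ s → s ≤ c → h s ≡ h 0 + s

  shifted⇒run : (∀ {t} → t < c → h (suc t) ≡ suc (h 0) + t) → Run
  shifted⇒run run zero    _   = sym (+-identityʳ (h 0))
  shifted⇒run run (suc t) t<c = trans (run t<c) (sym (+-suc (h 0) t))

  run⇒shifted : Run → ∀ {t} → t < c → h (suc t) ≡ suc (h 0) + t
  run⇒shifted run {t} t<c = trans (run (suc t) t<c) (+-suc (h 0) t)

  module _ (h0≤j : h 0 ≤ j) where

    c+h0≡j : c + h 0 ≡ j
    c+h0≡j = m∸n+n≡m h0≤j

    rest-position< : ∀ {i} → i < h 0 → suc (c + i) < suc j
    rest-position< i<h0 = s≤s (subst (c + _ <_) c+h0≡j (+-monoʳ-< c i<h0))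

    run-value< : ∀ {s} → s ≤ c → h 0 + s < suc j
    run-value< s≤c = s≤s (subst (h 0 + _ ≤_) (trans (+-comm (h 0) c) c+h0≡j) (+-monoʳ-≤ (h 0) s≤c))

    position-split : ∀ {a} → a < suc j → a ≤ c ⊎ ∃ λ i → i < h 0 × a ≡ suc (c + i)
    position-split {zero}  _ = inj₁ z≤n
    position-split {suc t} (s≤s t<j) with t <? c
    ... | yes t<c = inj₁ t<c
    ... | no  t≮c = inj₂ (t ∸ c , i<h0 , cong suc (sym (m+[n∸m]≡n (≮⇒≥ t≮c))))
      where
      i<h0 : t ∸ c < h 0
      i<h0 = subst (t ∸ c <_) (m∸[m∸n]≡n h0≤j) (∸-monoˡ-< t<j (≮⇒≥ t≮c))

    run+rest⇒perm : Run → PermOn (h 0) rest → PermOn (suc j) h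
    run+rest⇒perm run perm = record { bounded = bounded′ ; injective = injective′ }
      where
      open PermOn perm
      bounded′ : ∀ {a} → a < suc j → h a < suc j
      bounded′ a<J with position-split a<J
      ... | inj₁ a≤c = subst (_< suc j) (sym (run _ a≤c)) (run-value< a≤c)
      ... | inj₂ (i , i<h0 , refl) = <-trans (bounded i<h0) (s≤s h0≤j)
      injective′ : ∀ {a b} → a < suc j → b < suc j → h a ≡ h b → a ≡ b
      injective′ a<J b<J ha≡hb with position-split a<J | position-split b<J
      ... | inj₁ a≤c | inj₁ b≤c = +-cancelˡ-≡ (h 0) _ _ (trans (sym (run _ a≤c)) (trans ha≡hb (run _ b≤c)))
      ... | inj₁ a≤c | inj₂ (i , i<h0 , refl) =
            ⊥-elim (<⇒≱ (bounded i<h0) (subst (h 0 ≤_) (trans (sym (run _ a≤c)) ha≡hb) (m≤m+n (h 0) _)))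
      ... | inj₂ (i , i<h0 , refl) | inj₁ b≤c =
            ⊥-elim (<⇒≱ (bounded i<h0) (subst (h 0 ≤_) (trans (sym (run _ b≤c)) (sym ha≡hb)) (m≤m+n (h 0) _)))
      ... | inj₂ (i , i<h0 , refl) | inj₂ (i′ , i′<h0 , refl) =
            cong (λ z → suc (c + z)) (injective i<h0 i′<h0 ha≡hb)

    run+rest⇒rigid : Run → PermOn (h 0) rest → AscentsRigid (h 0) rest → AscentsRigid (suc j) h
    run+rest⇒rigid run perm rigid {a} {b} a<b b<J ha<hb with position-split (<-trans a<b b<J) | position-split b<J
    ... | inj₁ a≤c | inj₁ b≤c = begin
      h b + a          ≡⟨ cong (_+ a) (run b b≤c) ⟩
      h 0 + b + a      ≡⟨ xy∙z≈xz∙y (h 0) b a ⟩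
      h 0 + a + b      ≡⟨ cong (_+ b) (run a a≤c) ⟨
      h a + b          ∎
      where open ≡-Reasoning
    ... | inj₁ a≤c | inj₂ (i , i<h0 , refl) = ⊥-elim (<⇒≱ (PermOn.bounded perm i<h0)
            (≤-trans (subst (h 0 ≤_) (sym (run a a≤c)) (m≤m+n (h 0) a)) (<⇒≤ ha<hb)))
    ... | inj₂ (i , _ , refl) | inj₁ b≤c = ⊥-elim (<⇒≱ a<b (≤-trans b≤c (≤-trans (m≤m+n c i) (n≤1+n _))))
    ... | inj₂ (i , _ , refl) | inj₂ (i′ , i′<h0 , refl) = begin
      rest i′ + suc (c + i)  ≡⟨ +-suc-shift c (rest i′) i ⟩
      suc c + (rest i′ + i)  ≡⟨ cong (suc c +_) (rigid (+-cancelˡ-< (suc c) i i′ a<b) i′<h0 ha<hb) ⟩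
      suc c + (rest i + i′)  ≡⟨ +-suc-shift c (rest i) i′ ⟨
      rest i + suc (c + i′)  ∎
      where open ≡-Reasoning

  module _ (perm : PermOn (suc j) h) where
    open PermOn perm

    head≤j : h 0 ≤ j
    head≤j = ≤-pred (bounded z<s)

    -- The value h 0 + s sits at some position q > 0, and rigidity of the ascent 0 < q forces q = s.
    rigid⇒run : AscentsRigid (suc j) h → Run
    rigid⇒run rigid zero    _   = sym (+-identityʳ (h 0))
    rigid⇒run rigid (suc s) s<c = locate (surjective perm (run-value< head≤j s<c))
      where
      locate : (∃ λ q → q < suc j × h q ≡ h 0 + suc s) → h (suc s) ≡ h 0 + suc s
      locate (zero  , _   , h0≡v) = ⊥-elim (<-irrefl h0≡v (m<m+n (h 0) z<s))
      locate (suc q , q<J , hq≡v) = subst (λ p → h p ≡ h 0 + suc s) q≡s hq≡v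
        where
        h0<hq : h 0 < h (suc q)
        h0<hq = subst (h 0 <_) (sym hq≡v) (m<m+n (h 0) z<s)
        q≡s : suc q ≡ suc s
        q≡s = +-cancelˡ-≡ (h 0) _ _ (trans (sym (rigid z<s q<J h0<hq)) (trans (+-identityʳ _) hq≡v))

    rest-perm : Run → PermOn (h 0) rest
    rest-perm run = record { bounded = bounded′ ; injective = injective′ }
      where
      bounded′ : ∀ {i} → i < h 0 → rest i < h 0
      bounded′ {i} i<h0 with rest i <? h 0
      ... | yes rest<h0 = rest<h0
      ... | no  rest≮h0 = ⊥-elim (<⇒≱ (s≤s (m≤m+n c i)) (subst (_≤ c) s≡ s≤c))
        where
        s = rest i ∸ h 0
        s≤c : s ≤ c
        s≤c = ∸-monoˡ-≤ (h 0) (≤-pred (bounded (rest-position< head≤j i<h0)))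
        s≡ : s ≡ suc (c + i)
        s≡ = injective (≤-trans (s≤s s≤c) (s≤s (m∸n≤m j (h 0)))) (rest-position< head≤j i<h0)
               (trans (run s s≤c) (m+[n∸m]≡n (≮⇒≥ rest≮h0)))
      injective′ : ∀ {i i′} → i < h 0 → i′ < h 0 → rest i ≡ rest i′ → i ≡ i′
      injective′ i<h0 i′<h0 eq =
        +-cancelˡ-≡ c _ _ (suc-injective (injective (rest-position< head≤j i<h0) (rest-position< head≤j i′<h0) eq))

    rest-rigid : AscentsRigid (suc j) h → AscentsRigid (h 0) rest
    rest-rigid rigid {i} {i′} i<i′ i′<h0 lt = +-cancelˡ-≡ (suc c) _ _ (begin
      suc c + (rest i′ + i)  ≡⟨ +-suc-shift c (rest i′) i ⟨
      rest i′ + suc (c + i)  ≡⟨ rigid (s≤s (+-monoʳ-< c i<i′)) (rest-position< head≤j i′<h0) lt ⟩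
      rest i + suc (c + i′)  ≡⟨ +-suc-shift c (rest i) i′ ⟩
      suc c + (rest i + i′)  ∎)
      where open ≡-Reasoning

values : ∀ {N j} → Vec (Fin N) j → ℕ → ℕ
values []ᵥ       _       = 0
values (x ∷ᵥ _)  zero    = toℕ x
values (_ ∷ᵥ w)  (suc i) = values w i

values-lookup : ∀ {N j} (w : Vec (Fin N) j) i → values w (toℕ i) ≡ toℕ (lookup w i)
values-lookup (_ ∷ᵥ _) fz     = refl
values-lookup (_ ∷ᵥ w) (fs i) = values-lookup w i

values-fromℕ< : ∀ {N} (π : Word N) {a} (a<N : a < N) → values π a ≡ toℕ (lookup π (fromℕ< a<N))
values-fromℕ< π a<N = trans (cong (values π) (sym (toℕ-fromℕ< a<N))) (values-lookup π _)

both : ∀ {P Q : Set} → P → Q → (P → Q) × (Q → P)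
both p q = (λ _ → q) , (λ _ → p)

neither : ∀ {P Q : Set} → ¬ P → ¬ Q → (P → Q) × (Q → P)
neither ¬p ¬q = (⊥-elim ∘ ¬p) , (⊥-elim ∘ ¬q)

orderIso3-213 : ∀ {n} (w : Fin 3 → Fin n) →
                toℕ (w (fs fz)) < toℕ (w fz) → toℕ (w fz) < toℕ (w (fs (fs fz))) → OrderIso3 w p213
orderIso3-213 w w₁<w₀ w₀<w₂ fz           fz           = neither (<-irrefl refl) (<-irrefl refl)
orderIso3-213 w w₁<w₀ w₀<w₂ fz           (fs fz)      = neither (<-asym w₁<w₀) (<-asym z<s)
orderIso3-213 w w₁<w₀ w₀<w₂ fz           (fs (fs fz)) = both w₀<w₂ (s<s z<s)
orderIso3-213 w w₁<w₀ w₀<w₂ (fs fz)      fz           = both w₁<w₀ z<s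
orderIso3-213 w w₁<w₀ w₀<w₂ (fs fz)      (fs fz)      = neither (<-irrefl refl) (<-irrefl refl)
orderIso3-213 w w₁<w₀ w₀<w₂ (fs fz)      (fs (fs fz)) = both (<-trans w₁<w₀ w₀<w₂) z<s
orderIso3-213 w w₁<w₀ w₀<w₂ (fs (fs fz)) fz           = neither (<-asym w₀<w₂) (<-asym (s<s z<s))
orderIso3-213 w w₁<w₀ w₀<w₂ (fs (fs fz)) (fs fz)      = neither (<-asym (<-trans w₁<w₀ w₀<w₂)) (<-asym z<s)
orderIso3-213 w w₁<w₀ w₀<w₂ (fs (fs fz)) (fs (fs fz)) = neither (<-irrefl refl) (<-irrefl refl)

orderIso3-132 : ∀ {n} (w : Fin 3 → Fin n) →
                toℕ (w fz) < toℕ (w (fs (fs fz))) → toℕ (w (fs (fs fz))) < toℕ (w (fs fz)) → OrderIso3 w p132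
orderIso3-132 w w₀<w₂ w₂<w₁ fz           fz           = neither (<-irrefl refl) (<-irrefl refl)
orderIso3-132 w w₀<w₂ w₂<w₁ fz           (fs fz)      = both (<-trans w₀<w₂ w₂<w₁) z<s
orderIso3-132 w w₀<w₂ w₂<w₁ fz           (fs (fs fz)) = both w₀<w₂ z<s
orderIso3-132 w w₀<w₂ w₂<w₁ (fs fz)      fz           = neither (<-asym (<-trans w₀<w₂ w₂<w₁)) (<-asym z<s)
orderIso3-132 w w₀<w₂ w₂<w₁ (fs fz)      (fs fz)      = neither (<-irrefl refl) (<-irrefl refl)
orderIso3-132 w w₀<w₂ w₂<w₁ (fs fz)      (fs (fs fz)) = neither (<-asym w₂<w₁) (<-asym (s<s z<s))
orderIso3-132 w w₀<w₂ w₂<w₁ (fs (fs fz)) fz           = neither (<-asym w₀<w₂) (<-asym z<s)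
orderIso3-132 w w₀<w₂ w₂<w₁ (fs (fs fz)) (fs fz)      = both w₂<w₁ (s<s z<s)
orderIso3-132 w w₀<w₂ w₂<w₁ (fs (fs fz)) (fs (fs fz)) = neither (<-irrefl refl) (<-irrefl refl)

module _ {N : ℕ} (π : Word N) where

  private
    fromℕ<-mono : ∀ {a b} (a<N : a < N) (b<N : b < N) → a < b → toℕ (fromℕ< a<N) < toℕ (fromℕ< b<N)
    fromℕ<-mono a<N b<N = subst₂ _<_ (sym (toℕ-fromℕ< a<N)) (sym (toℕ-fromℕ< b<N))

    compare : ∀ {a b} (a<N : a < N) (b<N : b < N) → values π a < values π b →
              toℕ (lookup π (fromℕ< a<N)) < toℕ (lookup π (fromℕ< b<N))
    compare a<N b<N = subst₂ _<_ (values-fromℕ< π a<N) (values-fromℕ< π b<N)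

    compare⁻ : ∀ i j → toℕ (lookup π i) < toℕ (lookup π j) → values π (toℕ i) < values π (toℕ j)
    compare⁻ i j = subst₂ _<_ (sym (values-lookup π i)) (sym (values-lookup π j))

  isPerm⇒permOn : IsPerm π → PermOn N (values π)
  isPerm⇒permOn isPerm = record
    { bounded   = λ a<N → subst (_< N) (sym (values-fromℕ< π a<N)) (toℕ<n _)
    ; injective = λ a<N b<N eq → trans (sym (toℕ-fromℕ< a<N)) (trans
        (cong toℕ (isPerm _ _ (toℕ-injective (trans (sym (values-fromℕ< π a<N)) (trans eq (values-fromℕ< π b<N))))))
        (toℕ-fromℕ< b<N))
    }

  permOn⇒isPerm : PermOn N (values π) → IsPerm π
  permOn⇒isPerm perm i j eq = toℕ-injective (PermOn.injective perm (toℕ<n i) (toℕ<n j)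
    (trans (values-lookup π i) (trans (cong toℕ eq) (sym (values-lookup π j)))))

  avoids3⇒avoids213On : Avoids3 π p213 → Avoids213On N (values π)
  avoids3⇒avoids213On avoids {a} {b} {c} a<b b<c c<N vb<va va<vc =
    avoids (fromℕ< a<N , fromℕ< b<N , fromℕ< c<N , fromℕ<-mono a<N b<N a<b , fromℕ<-mono b<N c<N b<c ,
            orderIso3-213 _ (compare b<N a<N vb<va) (compare a<N c<N va<vc))
    where
    b<N = <-trans b<c c<N
    a<N = <-trans a<b b<N

  avoids3⇒avoids132On : Avoids3 π p132 → Avoids132On N (values π)
  avoids3⇒avoids132On avoids {a} {b} {c} a<b b<c c<N va<vc vc<vb =
    avoids (fromℕ< a<N , fromℕ< b<N , fromℕ< c<N , fromℕ<-mono a<N b<N a<b , fromℕ<-mono b<N c<N b<c ,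
            orderIso3-132 _ (compare a<N c<N va<vc) (compare c<N b<N vc<vb))
    where
    b<N = <-trans b<c c<N
    a<N = <-trans a<b b<N

  avoids213On⇒avoids3 : Avoids213On N (values π) → Avoids3 π p213
  avoids213On⇒avoids3 avoids (i , j , l , i<j , j<l , iso) =
    avoids i<j j<l (toℕ<n l) (compare⁻ j i (proj₂ (iso (fs fz) fz) z<s))
                             (compare⁻ i l (proj₂ (iso fz (fs (fs fz))) (s≤s z<s)))

  avoids132On⇒avoids3 : Avoids132On N (values π) → Avoids3 π p132
  avoids132On⇒avoids3 avoids (i , j , l , i<j , j<l , iso) =
    avoids i<j j<l (toℕ<n l) (compare⁻ i l (proj₂ (iso fz (fs (fs fz))) z<s))
                             (compare⁻ l j (proj₂ (iso (fs (fs fz)) (fs fz)) (s≤s z<s)))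

module Layering (k N : ℕ) .{{_ : NonZero k}} where

  -- Layered j v c g: the values g 0, …, g (j − 1), read as the last j letters of a word of
  -- length N, first continue a run with c more letters v, v + 1, …; after that every run starts
  -- at a value congruent to its position mod k and climbs to the largest value not yet used.
  Layered : ℕ → ℕ → ℕ → (ℕ → ℕ) → Set
  Layered zero    v c       g = c ≡ 0
  Layered (suc j) v (suc c) g = g 0 ≡ v × Layered j (suc v) c (g ∘ suc)
  Layered (suc j) v zero    g =
    g 0 ≤ j × g 0 % k ≡ (N ∸ suc j) % k × Layered j (suc (g 0)) (j ∸ g 0) (g ∘ suc)

  layered? : ∀ j v c g → Dec (Layered j v c g)
  layered? zero    v c       g = c ≟ 0
  layered? (suc j) v (suc c) g = (g 0 ≟ v) ×-dec layered? j (suc v) c (g ∘ suc)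
  layered? (suc j) v zero    g =
    (g 0 ≤? j) ×-dec ((g 0 % k ≟ (N ∸ suc j) % k) ×-dec layered? j (suc (g 0)) (j ∸ g 0) (g ∘ suc))

  layered-v-irrelevant : ∀ j {v w g} → Layered j v 0 g → Layered j w 0 g
  layered-v-irrelevant zero    l = l
  layered-v-irrelevant (suc j) l = l

  layered-run⁺ : ∀ c j {v g} → Layered j v c g →
                 c ≤ j × (∀ {t} → t < c → g t ≡ v + t) × Layered (j ∸ c) 0 0 (λ i → g (c + i))
  layered-run⁺ zero    j       l = z≤n , (λ ()) , layered-v-irrelevant j l
  layered-run⁺ (suc c) (suc j) {v} {g} (g0≡v , l) with c≤j , run , l′ ← layered-run⁺ c j l =
    s≤s c≤j , run′ , l′
    where
    run′ : ∀ {t} → t < suc c → g t ≡ v + t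
    run′ {zero}  _         = trans g0≡v (sym (+-identityʳ v))
    run′ {suc t} (s≤s t<c) = trans (run t<c) (sym (+-suc v t))

  layered-run⁻ : ∀ c j {v g} → c ≤ j → (∀ {t} → t < c → g t ≡ v + t) →
                 Layered (j ∸ c) 0 0 (λ i → g (c + i)) → Layered j v c g
  layered-run⁻ zero    j       _         _   l = layered-v-irrelevant j l
  layered-run⁻ (suc c) (suc j) {v} (s≤s c≤j) run l =
    trans (run z<s) (+-identityʳ v) ,
    layered-run⁻ c j c≤j (λ t<c → trans (run (s≤s t<c)) (+-suc v _)) l

  ModSuffix : ℕ → (ℕ → ℕ) → Set
  ModSuffix J h = ∀ {a} → a < J → h a % k ≡ (N ∸ J + a) % k

  module _ {j : ℕ} {h : ℕ → ℕ} (1+j≤N : suc j ≤ N) (h0≤j : h 0 ≤ j) where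
    open HeadRun j h

    suffix-offset : ∀ i → N ∸ suc j + suc (c + i) ≡ N ∸ h 0 + i
    suffix-offset i = begin
      N ∸ suc j + suc (c + i)  ≡⟨ +-assoc (N ∸ suc j) (suc c) i ⟨
      N ∸ suc j + suc c + i    ≡⟨ cong (_+ i) start-offset ⟩
      N ∸ h 0 + i              ∎
      where
      open ≡-Reasoning
      start-offset : N ∸ suc j + suc c ≡ N ∸ h 0
      start-offset = sym (begin
        N ∸ h 0                             ≡⟨ cong (_∸ h 0) (m∸n+n≡m 1+j≤N) ⟨
        (N ∸ suc j + suc j) ∸ h 0           ≡⟨ cong (λ z → (N ∸ suc j + suc z) ∸ h 0) (c+h0≡j h0≤j) ⟨
        (N ∸ suc j + (suc c + h 0)) ∸ h 0   ≡⟨ cong (_∸ h 0) (+-assoc (N ∸ suc j) (suc c) (h 0)) ⟨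
        (N ∸ suc j + suc c + h 0) ∸ h 0     ≡⟨ m+n∸n≡m (N ∸ suc j + suc c) (h 0) ⟩
        N ∸ suc j + suc c                   ∎)

    mod-glue : Run → h 0 % k ≡ (N ∸ suc j) % k → ModSuffix (h 0) rest → ModSuffix (suc j) h
    mod-glue run h0≡ mod a<J with position-split h0≤j a<J
    ... | inj₁ a≤c = trans (cong (_% k) (run _ a≤c)) (%-cong-+ʳ _ h0≡)
    ... | inj₂ (i , i<h0 , refl) = trans (mod i<h0) (cong (_% k) (sym (suffix-offset i)))

    mod-rest : ModSuffix (suc j) h → ModSuffix (h 0) rest
    mod-rest mod {i} i<h0 = trans (mod (rest-position< h0≤j i<h0)) (cong (_% k) (suffix-offset i))

  Admissible : ℕ → (ℕ → ℕ) → Set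
  Admissible J h = PermOn J h × AscentsRigid J h × ModSuffix J h

  layered⇒admissible : ∀ J {h} → J ≤ N → Layered J 0 0 h → Admissible J h
  layered⇒admissible = <-rec (λ J → ∀ {h} → J ≤ N → Layered J 0 0 h → Admissible J h) step
    where
    step : ∀ J → (∀ {J′} → J′ < J → ∀ {h} → J′ ≤ N → Layered J′ 0 0 h → Admissible J′ h) →
           ∀ {h} → J ≤ N → Layered J 0 0 h → Admissible J h
    step zero    _   _ _ = record { bounded = λ () ; injective = λ () } , (λ _ ()) , λ ()
    step (suc j) rec {h} 1+j≤N (h0≤j , h0≡ , l)
      with c≤j , run , l′ ← layered-run⁺ (j ∸ h 0) j l
      with perm , rigid , mod ← rec (s≤s h0≤j) (≤-trans h0≤j (<⇒≤ 1+j≤N))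
                                  (subst (λ J′ → Layered J′ 0 0 (HeadRun.rest j h)) (m∸[m∸n]≡n h0≤j) l′) =
      run+rest⇒perm h0≤j run′ perm , run+rest⇒rigid h0≤j run′ perm rigid , mod-glue 1+j≤N h0≤j run′ h0≡ mod
      where
      open HeadRun j h
      run′ : Run
      run′ = shifted⇒run run

  admissible⇒layered : ∀ J {h} → J ≤ N → Admissible J h → Layered J 0 0 h
  admissible⇒layered = <-rec (λ J → ∀ {h} → J ≤ N → Admissible J h → Layered J 0 0 h) step
    where
    step : ∀ J → (∀ {J′} → J′ < J → ∀ {h} → J′ ≤ N → Admissible J′ h → Layered J′ 0 0 h) →
           ∀ {h} → J ≤ N → Admissible J h → Layered J 0 0 h
    step zero    _   _ _ = refl
    step (suc j) rec {h} 1+j≤N (perm , rigid , mod) =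
      h0≤j , trans (mod z<s) (cong (_% k) (+-identityʳ _)) ,
      layered-run⁻ c j (m∸n≤m j (h 0)) (run⇒shifted run)
        (subst (λ J′ → Layered J′ 0 0 rest) (sym (m∸[m∸n]≡n h0≤j))
          (rec (s≤s h0≤j) (≤-trans h0≤j (<⇒≤ 1+j≤N))
               (rest-perm perm run , rest-rigid perm rigid , mod-rest 1+j≤N h0≤j mod)))
      where
      open HeadRun j h
      h0≤j : h 0 ≤ j
      h0≤j = head≤j perm
      run : Run
      run = rigid⇒run perm rigid

  -- ModAlt compares the 1-based values suc (toℕ …); ∣ suc a - suc b ∣ reduces to ∣ a - b ∣.
  modAlt⇒modSuffix : (π : Word N) → ModAlt k π → ModSuffix N (values π)
  modAlt⇒modSuffix π alt {a} a<N = begin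
    values π a % k                   ≡⟨ cong (_% k) (values-fromℕ< π a<N) ⟩
    toℕ (lookup π (fromℕ< a<N)) % k  ≡⟨ d∣∣m-n∣⇒m%d≡n%d _ _ (alt (fromℕ< a<N)) ⟩
    toℕ (fromℕ< a<N) % k             ≡⟨ cong (_% k) (toℕ-fromℕ< a<N) ⟩
    a % k                            ≡⟨ cong (λ z → (z + a) % k) (n∸n≡0 N) ⟨
    (N ∸ N + a) % k                  ∎
    where open ≡-Reasoning

  modSuffix⇒modAlt : (π : Word N) → ModSuffix N (values π) → ModAlt k π
  modSuffix⇒modAlt π mod i = m%d≡n%d⇒d∣∣m-n∣ _ _ (begin
    toℕ (lookup π i) % k  ≡⟨ cong (_% k) (values-lookup π i) ⟨
    values π (toℕ i) % k  ≡⟨ mod (toℕ<n i) ⟩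
    (N ∸ N + toℕ i) % k   ≡⟨ cong (λ z → (z + toℕ i) % k) (n∸n≡0 N) ⟩
    toℕ i % k             ∎)
    where open ≡-Reasoning

  good⇒layered : (π : Word N) → Good k π → Layered N 0 0 (values π)
  good⇒layered π (isPerm , alt , av213 , av132) = admissible⇒layered N ≤-refl
    (perm , avoids⇒ascentsRigid perm (avoids3⇒avoids213On π av213) (avoids3⇒avoids132On π av132) ,
     modAlt⇒modSuffix π alt)
    where
    perm = isPerm⇒permOn π isPerm

  layered⇒good : (π : Word N) → Layered N 0 0 (values π) → Good k π
  layered⇒good π l with perm , rigid , mod ← layered⇒admissible N ≤-refl l =
    permOn⇒isPerm π perm , modSuffix⇒modAlt π mod ,
    avoids213On⇒avoids3 π (ascentsRigid⇒avoids213 rigid) , avoids132On⇒avoids3 π (ascentsRigid⇒avoids132 rigid)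

  layeredCount : ℕ → ℕ → ℕ → ℕ
  layeredCount j v c = count (λ w → layered? j v c (values w)) (allWords N j)

  mp213-132≡layeredCount : mp213-132 N k ≡ layeredCount N 0 0
  mp213-132≡layeredCount =
    cong length (filter-≐ (good? k) _ ((λ {π} → good⇒layered π) , (λ {π} → layered⇒good π)) (allWords N N))

  layeredCount-run : ∀ j v c → v < N → layeredCount (suc j) v (suc c) ≡ layeredCount j (suc v) c
  layeredCount-run j v c v<N = begin
    layeredCount (suc j) v (suc c)
      ≡⟨ count-allWords-suc N _ (λ i → iverson (i ≟ v) (layeredCount j (suc v) c))
           (λ x → count-×-dec (toℕ x ≟ v) _ (allWords N j)) ⟩
    ∑[ i < N ] iverson (i ≟ v) (layeredCount j (suc v) c)
      ≡⟨ ∑<-single N v v<N (λ i _ i≢v → iverson-no (i ≟ v) i≢v) ⟩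
    iverson (v ≟ v) (layeredCount j (suc v) c)
      ≡⟨ iverson-yes (v ≟ v) refl ⟩
    layeredCount j (suc v) c ∎
    where open ≡-Reasoning

  layeredCount-runs : ∀ c j {v} → c ≤ j → v + c ≤ N → layeredCount j v c ≡ layeredCount (j ∸ c) 0 0
  layeredCount-runs zero    zero    _         _     = refl
  layeredCount-runs zero    (suc j) _         _     = refl
  layeredCount-runs (suc c) (suc j) {v} (s≤s c≤j) v+c<N =
    trans (layeredCount-run j v c (≤-trans (s≤s (m≤m+n v c)) v+c<N′))
          (layeredCount-runs c j c≤j v+c<N′)
    where
    v+c<N′ : suc v + c ≤ N
    v+c<N′ = subst (_≤ N) (+-suc v c) v+c<N

  layeredCount-start : ∀ j → suc j ≤ N →
    layeredCount (suc j) 0 0 ≡ ∑[ i < suc j ] iverson (i % k ≟ (N ∸ suc j) % k) (layeredCount i 0 0)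
  layeredCount-start j 1+j≤N = begin
    layeredCount (suc j) 0 0
      ≡⟨ count-allWords-suc N _ F (λ x → trans (count-×-dec (toℕ x ≤? j) _ (allWords N j))
           (cong (iverson (toℕ x ≤? j)) (count-×-dec (toℕ x % k ≟ r) _ (allWords N j)))) ⟩
    ∑< N F
      ≡⟨ ∑<-truncate 1+j≤N (λ i j<i _ → iverson-no (i ≤? j) (<⇒≱ j<i)) ⟩
    ∑< (suc j) F
      ≡⟨ ∑<-cong (suc j) (λ i i<1+j → trans (iverson-yes (i ≤? j) (≤-pred i<1+j))
           (cong (iverson (i % k ≟ r)) (run-count (≤-pred i<1+j)))) ⟩
    ∑[ i < suc j ] iverson (i % k ≟ r) (layeredCount i 0 0) ∎
    where
    open ≡-Reasoning
    r = (N ∸ suc j) % k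
    F : ℕ → ℕ
    F i = iverson (i ≤? j) (iverson (i % k ≟ r) (layeredCount j (suc i) (j ∸ i)))
    run-count : ∀ {i} → i ≤ j → layeredCount j (suc i) (j ∸ i) ≡ layeredCount i 0 0
    run-count {i} i≤j = trans
      (layeredCount-runs (j ∸ i) j (m∸n≤m j i) (subst (_≤ N) (cong suc (sym (m+[n∸m]≡n i≤j))) 1+j≤N))
      (cong (λ z → layeredCount z 0 0) (m∸[m∸n]≡n i≤j))

module Recurrence (k m l : ℕ) .{{_ : NonZero k}} (l<k : l < k) (f : ℕ → ℕ) (f0≡1 : f 0 ≡ 1)
  (f-rec : ∀ j → suc j ≤ k * m + l →
           f (suc j) ≡ ∑[ i < suc j ] iverson (i % k ≟ (k * m + l ∸ suc j) % k) (f i)) where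

  classSum : ℕ → ℕ → ℕ
  classSum r J = ∑[ i < J ] iverson (i % k ≟ r) (f i)

  classSum-0 : ∀ r → classSum r (k * 0) ≡ 0
  classSum-0 r = cong (classSum r) (*-zeroʳ k)

  residue : ∀ t {i} → i < k → (k * t + i) % k ≡ i
  residue t {i} i<k = begin
    (k * t + i) % k  ≡⟨ cong (_% k) (trans (+-comm (k * t) i) (cong (i +_) (*-comm k t))) ⟩
    (i + t * k) % k  ≡⟨ [m+kn]%n≡m%n i t k ⟩
    i % k            ≡⟨ m<n⇒m%n≡m i<k ⟩
    i                ∎
    where open ≡-Reasoning

  classSum-window : ∀ t {r d} → r < d → d ≤ k → classSum r (k * t + d) ≡ classSum r (k * t) + f (k * t + r)
  classSum-window t {r} {d} r<d d≤k = begin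
    classSum r (k * t + d)                                               ≡⟨ ∑<-+ (k * t) d _ ⟩
    classSum r (k * t) + ∑[ i < d ] iverson ((k * t + i) % k ≟ r) (f (k * t + i))
      ≡⟨ cong (classSum r (k * t) +_) (∑<-single d r r<d off-residue) ⟩
    classSum r (k * t) + iverson ((k * t + r) % k ≟ r) (f (k * t + r))
      ≡⟨ cong (classSum r (k * t) +_) (iverson-yes ((k * t + r) % k ≟ r) (residue t (<-≤-trans r<d d≤k))) ⟩
    classSum r (k * t) + f (k * t + r)                                   ∎
    where
    open ≡-Reasoning
    off-residue : ∀ i → i < d → i ≢ r → iverson ((k * t + i) % k ≟ r) (f (k * t + i)) ≡ 0
    off-residue i i<d i≢r = iverson-no ((k * t + i) % k ≟ r) (i≢r ∘ trans (sym (residue t (<-≤-trans i<d d≤k))))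

  classSum-period : ∀ t {r} → r < k → classSum r (k * suc t) ≡ classSum r (k * t) + f (k * t + r)
  classSum-period t r<k =
    trans (cong (classSum _) (trans (*-suc k t) (+-comm k (k * t)))) (classSum-window t r<k ≤-refl)

  f-at : ∀ J → 0 < J → J ≤ k * m + l → f J ≡ classSum ((k * m + l ∸ J) % k) J
  f-at (suc j) _ = f-rec j

  f-multiple : ∀ t → suc t ≤ m → f (k * suc t) ≡ classSum l (k * suc t)
  f-multiple t 1+t≤m = trans (f-at (k * suc t) 0<J (≤-trans J≤km (m≤m+n (k * m) l)))
                             (cong (λ r → classSum r (k * suc t)) remainder)
    where
    0<J : 0 < k * suc t
    0<J = <-≤-trans (>-nonZero⁻¹ k) (m≤m*n k (suc t))
    J≤km : k * suc t ≤ k * m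
    J≤km = *-monoʳ-≤ k 1+t≤m
    remainder : (k * m + l ∸ k * suc t) % k ≡ l
    remainder = trans (cong (_% k) (trans (+-∸-comm l J≤km) (cong (_+ l) (sym (*-distribˡ-∸ k m (suc t))))))
                      (residue (m ∸ suc t) l<k)

  f-offset : ∀ t → 0 < l → t ≤ m → f (k * t + l) ≡ classSum 0 (k * t) + f (k * t)
  f-offset t 0<l t≤m = begin
    f (k * t + l)                      ≡⟨ f-at (k * t + l) 0<J (+-monoˡ-≤ l (*-monoʳ-≤ k t≤m)) ⟩
    classSum ((k * m + l ∸ (k * t + l)) % k) (k * t + l) ≡⟨ cong (λ r → classSum r (k * t + l)) remainder ⟩
    classSum 0 (k * t + l)             ≡⟨ classSum-window t 0<l (<⇒≤ l<k) ⟩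
    classSum 0 (k * t) + f (k * t + 0) ≡⟨ cong (λ z → classSum 0 (k * t) + f z) (+-identityʳ (k * t)) ⟩
    classSum 0 (k * t) + f (k * t)     ∎
    where
    open ≡-Reasoning
    0<J : 0 < k * t + l
    0<J = <-≤-trans 0<l (m≤n+m l (k * t))
    remainder : (k * m + l ∸ (k * t + l)) % k ≡ 0
    remainder = begin
      (k * m + l ∸ (k * t + l)) % k  ≡⟨ cong₂ (λ a b → (a ∸ b) % k) (+-comm (k * m) l) (+-comm (k * t) l) ⟩
      (l + k * m ∸ (l + k * t)) % k  ≡⟨ cong (_% k) ([m+n]∸[m+o]≡n∸o l (k * m) (k * t)) ⟩
      (k * m ∸ k * t) % k            ≡⟨ cong (_% k) (*-distribˡ-∸ k m t) ⟨
      (k * (m ∸ t)) % k              ≡⟨ cong (_% k) (*-comm k (m ∸ t)) ⟩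
      ((m ∸ t) * k) % k              ≡⟨ m*n%n≡0 (m ∸ t) k ⟩
      0                              ∎

  module _ (l≡0 : l ≡ 0) where

    f-multiple₀ : ∀ t → suc t ≤ m → f (k * suc t) ≡ classSum 0 (k * suc t)
    f-multiple₀ t 1+t≤m = subst (λ r → f (k * suc t) ≡ classSum r (k * suc t)) l≡0 (f-multiple t 1+t≤m)

    doubling : ∀ t → suc t ≤ m → classSum 0 (k * suc t) ≡ 2 ^ t
    doubling zero _ = begin
      classSum 0 (k * 1)              ≡⟨ classSum-period 0 (>-nonZero⁻¹ k) ⟩
      classSum 0 (k * 0) + f (k * 0 + 0) ≡⟨ cong₂ _+_ (classSum-0 0) (cong f (trans (+-identityʳ _) (*-zeroʳ k))) ⟩
      f 0                             ≡⟨ f0≡1 ⟩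
      1                               ∎
      where open ≡-Reasoning
    doubling (suc t) 2+t≤m = begin
      classSum 0 (k * suc (suc t))                     ≡⟨ classSum-period (suc t) (>-nonZero⁻¹ k) ⟩
      classSum 0 (k * suc t) + f (k * suc t + 0)       ≡⟨ cong (λ z → classSum 0 (k * suc t) + f z) (+-identityʳ _) ⟩
      classSum 0 (k * suc t) + f (k * suc t)           ≡⟨ cong (classSum 0 (k * suc t) +_) (f-multiple₀ t 1+t≤m) ⟩
      classSum 0 (k * suc t) + classSum 0 (k * suc t)  ≡⟨ cong (λ z → z + z) (doubling t 1+t≤m) ⟩
      2 ^ t + 2 ^ t                                    ≡⟨ cong (2 ^ t +_) (+-identityʳ _) ⟨
      2 ^ suc t                                        ∎
      where
      open ≡-Reasoning
      1+t≤m = ≤-trans (n≤1+n _) 2+t≤m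

    f-power : 0 < m → f (k * m + l) ≡ 2 ^ (m ∸ 1)
    f-power 0<m = begin
      f (k * m + l)                 ≡⟨ cong f (trans (cong₂ (λ a b → k * a + b) m≡ l≡0) (+-identityʳ _)) ⟩
      f (k * suc (m ∸ 1))           ≡⟨ f-multiple₀ (m ∸ 1) (≤-reflexive (sym m≡)) ⟩
      classSum 0 (k * suc (m ∸ 1))  ≡⟨ doubling (m ∸ 1) (≤-reflexive (sym m≡)) ⟩
      2 ^ (m ∸ 1)                   ∎
      where
      open ≡-Reasoning
      m≡ : m ≡ suc (m ∸ 1)
      m≡ = sym (trans (+-comm 1 (m ∸ 1)) (m∸n+n≡m 0<m))

  module _ (0<l : 0 < l) where

    fibonacci : ∀ t → t ≤ m →
      f (k * t + l) ≡ fib (suc (2 * t)) × classSum l (k * t) + f (k * t + l) ≡ fib (suc (suc (2 * t)))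
    fibonacci zero _ = f-base , cong₂ _+_ (classSum-0 l) f-base
      where
      f-base : f (k * 0 + l) ≡ 1
      f-base = trans (f-offset 0 0<l z≤n) (cong₂ _+_ (classSum-0 0) (trans (cong f (*-zeroʳ k)) f0≡1))
    fibonacci (suc t) 1+t≤m with f≡ , sum≡ ← fibonacci t (≤-trans (n≤1+n t) 1+t≤m) =
      trans f′≡ 2+2t≡ , trans (cong₂ _+_ l-class f′≡) 3+2t≡
      where
      open ≡-Reasoning
      2+2t≡ : fib (suc (suc (suc (2 * t)))) ≡ fib (suc (2 * suc t))
      2+2t≡ = cong (λ z → fib (suc z)) (sym (*-suc 2 t))
      3+2t≡ : fib (suc (suc (suc (suc (2 * t))))) ≡ fib (suc (suc (2 * suc t)))
      3+2t≡ = cong (λ z → fib (suc (suc z))) (sym (*-suc 2 t))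
      zero-class : classSum 0 (k * suc t) ≡ fib (suc (2 * t))
      zero-class = begin
        classSum 0 (k * suc t)              ≡⟨ classSum-period t (>-nonZero⁻¹ k) ⟩
        classSum 0 (k * t) + f (k * t + 0)  ≡⟨ cong (λ z → classSum 0 (k * t) + f z) (+-identityʳ _) ⟩
        classSum 0 (k * t) + f (k * t)      ≡⟨ f-offset t 0<l (≤-trans (n≤1+n t) 1+t≤m) ⟨
        f (k * t + l)                       ≡⟨ f≡ ⟩
        fib (suc (2 * t))                   ∎
      l-class : classSum l (k * suc t) ≡ fib (suc (suc (2 * t)))
      l-class = trans (classSum-period t l<k) sum≡
      f′≡ : f (k * suc t + l) ≡ fib (suc (suc (suc (2 * t))))
      f′≡ = begin
        f (k * suc t + l)                            ≡⟨ f-offset (suc t) 0<l 1+t≤m ⟩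
        classSum 0 (k * suc t) + f (k * suc t)       ≡⟨ cong₂ _+_ zero-class (trans (f-multiple t 1+t≤m) l-class) ⟩
        fib (suc (2 * t)) + fib (suc (suc (2 * t)))  ∎

    f-fibonacci : f (k * m + l) ≡ fib (2 * m + 1)
    f-fibonacci = trans (proj₁ (fibonacci m ≤-refl)) (cong fib (+-comm 1 (2 * m)))

mainTheorem11 : (k m l : ℕ) → 1 ≤ k → l < k → 1 ≤ k * m + l →
    (l ≡ 0 → mp213-132 (k * m + l) k ≡ 2 ^ (m ∸ 1)) ×
    (l ≢ 0 → mp213-132 (k * m + l) k ≡ fib (2 * m + 1))
mainTheorem11 k m l 1≤k l<k 0<n =
  (λ l≡0 → trans mp213-132≡layeredCount (f-power l≡0 (0<m l≡0))) ,
  (λ l≢0 → trans mp213-132≡layeredCount (f-fibonacci (n≢0⇒n>0 l≢0)))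
  where
  instance
    k≢0 : NonZero k
    k≢0 = >-nonZero 1≤k
  open Layering k (k * m + l)
  open Recurrence k m l l<k (λ J → layeredCount J 0 0) refl layeredCount-start
  0<m : l ≡ 0 → 0 < m
  0<m l≡0 = n≢0⇒n>0 λ m≡0 →
    m<n⇒n≢0 0<n (trans (cong₂ (λ a b → k * a + b) m≡0 l≡0) (trans (+-identityʳ _) (*-zeroʳ k)))
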